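{- Let $\mathcal{V}$ be a set of signed subsets of a set $E$. If $U$ is a signed subset of $E$ such that $V$ is orthogonal to $U$ for all $V\in\mathcal{V}$, then $U$ is orthogonal to every composition of the signed subsets of $\mathcal{V}$.
   Context: A signed subset $X$ of $E$ is a support $\underline{X}\subseteq E$ with a partition $(X^+,X^-)$; write $X(e)=1$ if $e\in X^+$, $X(e)=-1$ if $e\in X^-$, and $X(e)=0$ if $e\notin\underline{X}$. $X,Y$ are orthogonal if $\underline{X}\cap\underline{Y}=\emptyset$ or there are $e,f\in\underline{X}\cap\underline{Y}$ with $X(e)Y(e)=-X(f)Y(f)$. Composition: given a well-ordering $<$ of $\mathcal{V}$, order-isomorphic to the ordinal $\alpha$ via $\beta\mapsto V^\beta$, the composition of $\mathcal{V}$ according to $<$ is the signed subset $W$ with $\underline{W}=\bigcup_{V\in\mathcal{V}}\underline{V}$ and, for $e\in\underline{W}$, $W(e)=V^\gamma(e)$ where $\gamma=\min\{\beta<\alpha: V^\beta(e)\neq0\}$. A signed subset is a composition of the signed subsets of $\mathcal{V}$ if it is the composition according to some well-ordering of $\mathcal{V}$. -}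

module Defs where

open import Level using (0ℓ)
open import Data.Product using (Σ; ∃; _×_; _,_)
open import Data.Sum using (_⊎_)
open import Relation.Nullary using (¬_)
open import Relation.Binary.PropositionalEquality using (_≡_; _≢_)
open import Relation.Binary.Core using (Rel)
open import Relation.Binary.Structures using (IsStrictTotalOrder)
open import Induction.WellFounded using (WellFounded)

data Sign : Set where
  pos neg zer : Sign

_·_ : Sign → Sign → Sign
zer · _   = zer
_   · zer = zer
pos · pos = pos
neg · neg = pos
pos · neg = neg
neg · pos = neg

-ˢ_ : Sign → Sign
-ˢ pos = neg
-ˢ neg = pos
-ˢ zer = zer

-- A signed subset X of E: X(e) = 1 iff e ∈ X⁺, -1 iff e ∈ X⁻, 0 iff e ∉ supp X.
SignedSubset : Set → Set
SignedSubset E = E → Sign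

_∈supp_ : {E : Set} → E → SignedSubset E → Set
e ∈supp X = X e ≢ zer

Orthogonal : {E : Set} → SignedSubset E → SignedSubset E → Set
Orthogonal {E} X Y =
  (∀ e → ¬ (e ∈supp X × e ∈supp Y))
  ⊎ Σ E (λ e → Σ E (λ f →
      (e ∈supp X × e ∈supp Y) × (f ∈supp X × f ∈supp Y)
      × (X e · Y e ≡ -ˢ (X f · Y f))))

record IsWellOrder {I : Set} (_<_ : Rel I 0ℓ) : Set where
  field
    isStrictTotalOrder : IsStrictTotalOrder _≡_ _<_
    wellFounded        : WellFounded _<_

IsCompositionAccording : {E I : Set} (V : I → SignedSubset E)
                         (_<_ : Rel I 0ℓ) (W : SignedSubset E) → Set
IsCompositionAccording {E} {I} V _<_ W = ∀ (e : E) →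
    (W e ≡ zer × (∀ i → V i e ≡ zer))
  ⊎ Σ I (λ γ → V γ e ≢ zer × W e ≡ V γ e × (∀ β → β < γ → V β e ≡ zer))

-- Suppose U meets the support of the composition W. Among the indices γ for
-- which V γ meets the support of U, choose (classically) a least one. On the
-- common support of U and V γ, no earlier V β is nonzero, so W coincides with
-- V γ there; the two elements witnessing the orthogonality of V γ and U lie in
-- that common support, hence witness the orthogonality of U and W.
module Submission where

open import Defs
open import Level using (0ℓ)
open import Data.Product using (∃; _×_; _,_)
open import Data.Sum using (inj₁; inj₂)
open import Data.Empty using (⊥-elim)
open import Relation.Nullary using (yes; no; ¬_)
open import Relation.Binary.PropositionalEquality using (_≡_; refl; sym; trans)
open import Relation.Binary.Core using (Rel)
open import Relation.Binary.Definitions using (Trichotomous; tri<; tri≈; tri>)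
open import Relation.Binary.Structures using (IsStrictTotalOrder)
open import Axiom.ExcludedMiddle using (ExcludedMiddle)
open import Induction.WellFounded using (WellFounded; Acc; acc)

·-comm : ∀ a b → a · b ≡ b · a
·-comm pos pos = refl
·-comm pos neg = refl
·-comm pos zer = refl
·-comm neg pos = refl
·-comm neg neg = refl
·-comm neg zer = refl
·-comm zer pos = refl
·-comm zer neg = refl
·-comm zer zer = refl

sign-≡zer-stable : ∀ {s} → ¬ ¬ (s ≡ zer) → s ≡ zer
sign-≡zer-stable {pos} h = ⊥-elim (h (λ ()))
sign-≡zer-stable {neg} h = ⊥-elim (h (λ ()))
sign-≡zer-stable {zer} _ = refl

module _ {E : Set} where

  _meets_ : SignedSubset E → SignedSubset E → Set
  X meets Y = ∃ λ e → e ∈supp X × e ∈supp Y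

  Orthogonal-sym : {X Y : SignedSubset E} → Orthogonal X Y → Orthogonal Y X
  Orthogonal-sym (inj₁ disjoint) = inj₁ λ e (eY , eX) → disjoint e (eX , eY)
  Orthogonal-sym {X} {Y} (inj₂ (e , f , (eX , eY) , (fX , fY) , sign)) =
    inj₂ (e , f , (eY , eX) , (fY , fX) , signYX)
    where
    signYX : Y e · X e ≡ -ˢ (Y f · X f)
    signYX rewrite ·-comm (Y e) (X e) | ·-comm (Y f) (X f) = sign

  -- The witnesses of orthogonality lie in the common support of X and Y.
  Orthogonal-agreeOn : {X Y Z : SignedSubset E} → X meets Y →
    (∀ e → e ∈supp X → e ∈supp Y → Z e ≡ X e) →
    Orthogonal X Y → Orthogonal Z Y
  Orthogonal-agreeOn (e , common) _ (inj₁ disjoint) = ⊥-elim (disjoint e common)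
  Orthogonal-agreeOn {X} {Y} {Z} _ Z≡X (inj₂ (e , f , (eX , eY) , (fX , fY) , sign)) =
    inj₂ (e , f , (∈supp-Z eX eY , eY) , (∈supp-Z fX fY , fY) , signZY)
    where
    ∈supp-Z : ∀ {d} → d ∈supp X → d ∈supp Y → d ∈supp Z
    ∈supp-Z dX dY Zd≡zer = dX (trans (sym (Z≡X _ dX dY)) Zd≡zer)

    signZY : Z e · Y e ≡ -ˢ (Z f · Y f)
    signZY rewrite Z≡X e eX eY | Z≡X f fX fY = sign

module _ (em : ExcludedMiddle 0ℓ) {I : Set} {_<_ : Rel I 0ℓ} (wf : WellFounded _<_)
         (P : I → Set) where

  wellFounded⇒minimal : ∀ {i} → P i → ∃ λ γ → P γ × (∀ β → β < γ → ¬ P β)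
  wellFounded⇒minimal {i} = go (wf i)
    where
    go : ∀ {i} → Acc _<_ i → P i → ∃ λ γ → P γ × (∀ β → β < γ → ¬ P β)
    go {i} (acc rs) Pi with em {∃ λ β → β < i × P β}
    ... | yes (β , β<i , Pβ) = go (rs β<i) Pβ
    ... | no  ¬smaller      = i , Pi , λ β β<i Pβ → ¬smaller (β , β<i , Pβ)

module _ {E I : Set} {V : I → SignedSubset E} {_<_ : Rel I 0ℓ} {W : SignedSubset E}
         (composition : IsCompositionAccording V _<_ W) where

  composition-supp : ∀ {e} → e ∈supp W → ∃ λ γ → e ∈supp V γ
  composition-supp {e} eW with composition e
  ... | inj₁ (We≡zer , _)  = ⊥-elim (eW We≡zer)
  ... | inj₂ (γ , eVγ , _) = γ , eVγ

  composition-value : Trichotomous _≡_ _<_ → ∀ {γ e} →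
    (∀ β → β < γ → V β e ≡ zer) → e ∈supp V γ → W e ≡ V γ e
  composition-value compare {γ} {e} earlier-zer eVγ with composition e
  ... | inj₁ (_ , all-zer) = ⊥-elim (eVγ (all-zer γ))
  ... | inj₂ (γ′ , eVγ′ , We≡Vγ′e , earlier′-zer) with compare γ′ γ
  ...   | tri< γ′<γ _ _ = ⊥-elim (eVγ′ (earlier-zer γ′ γ′<γ))
  ...   | tri≈ _ refl _ = We≡Vγ′e
  ...   | tri> _ _ γ<γ′ = ⊥-elim (eVγ (earlier′-zer γ γ<γ′))

proposition3p13 : ExcludedMiddle 0ℓ →
    {E : Set} {I : Set} (V : I → SignedSubset E) →
    (∀ i j → (∀ e → V i e ≡ V j e) → i ≡ j) →
    (U : SignedSubset E) →
    (∀ i → Orthogonal (V i) U) →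
    (_<_ : Rel I 0ℓ) → IsWellOrder _<_ →
    (W : SignedSubset E) → IsCompositionAccording V _<_ W →
    Orthogonal U W
proposition3p13 em V _ U orth _<_ wo W composition with em {U meets W}
... | no ¬meets = inj₁ λ e common → ¬meets (e , common)
... | yes (e , eU , eW) with composition-supp composition eW
...   | γ₀ , eVγ₀
      with wellFounded⇒minimal em (IsWellOrder.wellFounded wo) (λ γ → V γ meets U) (e , eVγ₀ , eU)
...     | γ , Vγ-meets-U , earlier-disjoint =
  Orthogonal-sym (Orthogonal-agreeOn Vγ-meets-U W≡Vγ (orth γ))
  where
  open IsStrictTotalOrder (IsWellOrder.isStrictTotalOrder wo) using (compare)

  W≡Vγ : ∀ d → d ∈supp V γ → d ∈supp U → W d ≡ V γ d
  W≡Vγ d dVγ dU = composition-value composition compare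
    (λ β β<γ → sign-≡zer-stable λ dVβ → earlier-disjoint β β<γ (d , dVβ , dU)) dVγ
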